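{- Let $r\ge 2$ and $F=\begin{bmatrix}1&1\\0&1\\0&0\end{bmatrix}$. Then $\mathrm{forb}(m,r,\mathrm{Sym}(F))=\Theta(m^{r-1})$.
   Context: An $r$-matrix is a matrix with entries in $\{0,1,\dots,r-1\}$; a matrix is simple if it has no repeated columns. $F\prec A$ means some submatrix of $A$ is a row and column permutation of $F$. $\mathrm{forb}(m,r,\mathcal F)$ is the maximum number of columns of a simple $m$-rowed $r$-matrix $A$ with $F\not\prec A$ for all $F\in\mathcal F$. For a $(0,1)$-matrix $F$, $F(i,j)$ replaces each $0$ by $i$ and each $1$ by $j$; $\mathrm{Sym}(F)=\{F(i,j):0\le i<j\le r-1\}$. Asymptotics are as $m\to\infty$ with $r$ fixed. -}

module Defs where

open import Data.Nat using (ℕ; _*_; _^_; _∸_) renaming (_≤_ to _≤ℕ_)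
open import Data.Fin using (Fin; zero; suc; _<_)
open import Data.Product using (Σ; ∃; _×_; _,_)
open import Relation.Binary.PropositionalEquality using (_≡_)
open import Relation.Nullary using (¬_)
open import Function.Definitions using (Injective)

Matrix : ℕ → ℕ → ℕ → Set
Matrix r m n = Fin m → Fin n → Fin r

Simple : ∀ {r m n} → Matrix r m n → Set
Simple {m = m} {n = n} A = ∀ (j k : Fin n) → (∀ (i : Fin m) → A i j ≡ A i k) → j ≡ k

-- F ≺ A : some submatrix of A is a row and column permutation of F,
-- i.e. there are injective maps of rows and columns of F into those of A
-- under which the entries agree.
_≺_ : ∀ {r p q m n} → Matrix r p q → Matrix r m n → Set
_≺_ {p = p} {q} {m} {n} F A =
  Σ (Fin p → Fin m) λ ρ → Σ (Fin q → Fin n) λ γ →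
    Injective _≡_ _≡_ ρ × Injective _≡_ _≡_ γ ×
    (∀ i j → A (ρ i) (γ j) ≡ F i j)

F : Matrix 2 3 2
F zero          zero       = suc zero
F zero          (suc zero) = suc zero
F (suc zero)    zero       = zero
F (suc zero)    (suc zero) = suc zero
F (suc (suc zero)) zero       = zero
F (suc (suc zero)) (suc zero) = zero

subst01 : ∀ {r p q} → Matrix 2 p q → Fin r → Fin r → Matrix r p q
subst01 G i j a b with G a b
... | zero  = i
... | suc _ = j

AvoidsSym : ∀ {r p q m n} → Matrix 2 p q → Matrix r m n → Set
AvoidsSym {r} G A = ∀ (i j : Fin r) → i < j → ¬ (subst01 G i j ≺ A)

module Submission where

-- If some row b of a Sym(F)-avoiding matrix has values I < J in
-- two columns j, k, and each of I, J also occurs in a common row of both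
-- columns, then those two rows together with b and the columns j, k form a
-- copy of F(I,J).  Hence two columns that "share a row" for every value they
-- contain are equal.  Recording the top entry of a column and, for each of the
-- other r-1 values, one row where it occurs (or its absence), therefore
-- determines a column of a simple Sym(F)-avoiding matrix, so n ≤ r(m+1)^(r-1).
--
-- Split s·q ≤ m rows into blocks (t,u) with t < s = r-1 and
-- u < q = ⌊m/s⌋; the column indexed by g : Fin s → Fin q has value t+1 exactly
-- in row (t, g t) and 0 elsewhere.  Nonzero values never repeat in a column, so
-- no F(i,j) (which repeats j in a column) occurs; the q^s columns are distinct.

open import Defs
open import Data.Nat using (ℕ; zero; suc; _+_; _*_; _^_; _∸_; _≤_; _<_; z≤n; s≤s; _/_; _%_; _<?_; NonZero)
import Data.Nat.Properties as ℕ
open import Data.Nat.DivMod using (m≡m%n+[m/n]*n; m%n<n; m≥n⇒m/n>0; m/n*n≤m)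
open import Data.Nat.Solver using (module +-*-Solver)
open import Data.Fin as Fin using (Fin; zero; suc; toℕ; fromℕ<; combine; remQuot; punchIn; punchOut; finToFun; funToFin)
open import Data.Fin.Properties
  using (_≟_; <-cmp; any?; combine-injectiveˡ; combine-injectiveʳ; injective⇒≤; punchIn-punchOut;
         toℕ-fromℕ<; toℕ-injective; toℕ<n; combine-remQuot; remQuot-combine; finToFun-funToFin; funToFin-finToFin)
open import Data.Maybe using (Maybe; just; nothing)
open import Data.Maybe.Properties using (just-injective)
open import Data.Product using (Σ; ∃; _×_; _,_; uncurry)
open import Data.Product.Properties using (,-injectiveʳ)
open import Data.Sum using (_⊎_; inj₁; inj₂; swap)
open import Data.Empty using (⊥-elim)
open import Function using (_∘_)
open import Function.Definitions using (Injective)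
open import Relation.Nullary using (Dec; yes; no)
open import Relation.Binary using (tri<; tri≈; tri>)
open import Relation.Binary.PropositionalEquality
  using (_≡_; _≢_; refl; sym; trans; cong; cong₂; subst; module ≡-Reasoning)

funToFin-injective : ∀ {k a} (f g : Fin k → Fin a) → funToFin f ≡ funToFin g → ∀ t → f t ≡ g t
funToFin-injective f g eq t = begin
  f t                     ≡⟨ sym (finToFun-funToFin f t) ⟩
  finToFun (funToFin f) t ≡⟨ cong (λ i → finToFun i t) eq ⟩
  finToFun (funToFin g) t ≡⟨ finToFun-funToFin g t ⟩
  g t                     ∎
  where open ≡-Reasoning

funToFin-cong : ∀ {k a} {f g : Fin k → Fin a} → (∀ t → f t ≡ g t) → funToFin f ≡ funToFin g
funToFin-cong {zero}  _ = refl
funToFin-cong {suc k} h = cong₂ combine (h zero) (funToFin-cong (h ∘ suc))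

finToFun-injective : ∀ a k (i j : Fin (a ^ k)) → (∀ t → finToFun {a} {k} i t ≡ finToFun j t) → i ≡ j
finToFun-injective a k i j h = begin
  i                             ≡⟨ sym (funToFin-finToFin {k} {a} i) ⟩
  funToFin (finToFun {a} {k} i) ≡⟨ funToFin-cong {k} {a} h ⟩
  funToFin (finToFun {a} {k} j) ≡⟨ funToFin-finToFin {k} {a} j ⟩
  j                             ∎
  where open ≡-Reasoning

-- A copy of F(I,J) = [[J,J],[I,J],[I,I]] in rows x, y, z and columns u, v.
-- The rows are automatically distinct since each pair differs in u or v.
F-copy : ∀ {r m n} (A : Matrix r m n) {I J : Fin r} → I ≢ J → {u v : Fin n} → u ≢ v →
         {x y z : Fin m} →
         A x u ≡ J → A y u ≡ I → A z u ≡ I →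
         A x v ≡ J → A y v ≡ J → A z v ≡ I →
         subst01 F I J ≺ A
F-copy A {I} {J} I≢J {u} {v} u≢v {x} {y} {z} xu yu zu xv yv zv = ρ , γ , ρ-inj , γ-inj , agree
  where
  separated : ∀ {a b c} {P Q : Fin _} → A a c ≡ P → A b c ≡ Q → P ≢ Q → a ≢ b
  separated pa qb P≢Q refl = P≢Q (trans (sym pa) qb)

  x≢y : x ≢ y
  x≢y = separated xu yu (I≢J ∘ sym)
  x≢z : x ≢ z
  x≢z = separated xu zu (I≢J ∘ sym)
  y≢z : y ≢ z
  y≢z = separated yv zv (I≢J ∘ sym)

  ρ : Fin 3 → Fin _
  ρ zero             = x
  ρ (suc zero)       = y
  ρ (suc (suc zero)) = z

  γ : Fin 2 → Fin _
  γ zero       = u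
  γ (suc zero) = v

  ρ-inj : Injective _≡_ _≡_ ρ
  ρ-inj {zero}             {zero}             _  = refl
  ρ-inj {zero}             {suc zero}         eq = ⊥-elim (x≢y eq)
  ρ-inj {zero}             {suc (suc zero)}   eq = ⊥-elim (x≢z eq)
  ρ-inj {suc zero}         {zero}             eq = ⊥-elim (x≢y (sym eq))
  ρ-inj {suc zero}         {suc zero}         _  = refl
  ρ-inj {suc zero}         {suc (suc zero)}   eq = ⊥-elim (y≢z eq)
  ρ-inj {suc (suc zero)}   {zero}             eq = ⊥-elim (x≢z (sym eq))
  ρ-inj {suc (suc zero)}   {suc zero}         eq = ⊥-elim (y≢z (sym eq))
  ρ-inj {suc (suc zero)}   {suc (suc zero)}   _  = refl

  γ-inj : Injective _≡_ _≡_ γ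
  γ-inj {zero}     {zero}     _  = refl
  γ-inj {zero}     {suc zero} eq = ⊥-elim (u≢v eq)
  γ-inj {suc zero} {zero}     eq = ⊥-elim (u≢v (sym eq))
  γ-inj {suc zero} {suc zero} _  = refl

  agree : ∀ a b → A (ρ a) (γ b) ≡ subst01 F I J a b
  agree zero             zero       = xu
  agree zero             (suc zero) = xv
  agree (suc zero)       zero       = yu
  agree (suc zero)       (suc zero) = yv
  agree (suc (suc zero)) zero       = zu
  agree (suc (suc zero)) (suc zero) = zv

SharedRows : ∀ {r m n} → Matrix r m n → Fin n → Fin n → Set
SharedRows {m = m} A j k =
  ∀ w b → A b j ≡ w ⊎ A b k ≡ w → ∃ λ (a : Fin m) → A a j ≡ w × A a k ≡ w

SharedRows-sym : ∀ {r m n} (A : Matrix r m n) {j k} → SharedRows A j k → SharedRows A k j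
SharedRows-sym A shared w b occurs with shared w b (swap occurs)
... | a , aj , ak = a , ak , aj

-- Columns sharing rows that differ in row b with A b j < A b k contain
-- F(A b j, A b k): rows "J in both", b, "I in both".
shared-conflict⇒F-copy : ∀ {r m n} (A : Matrix r m n) {j k} → SharedRows A j k →
                         ∀ b → A b j Fin.< A b k → subst01 F (A b j) (A b k) ≺ A
shared-conflict⇒F-copy A {j} {k} shared b lt
  with shared (A b j) b (inj₁ refl) | shared (A b k) b (inj₂ refl)
... | aI , aIj , aIk | aJ , aJj , aJk =
  F-copy A I≢J (λ { refl → I≢J refl }) aJj refl aIj aJk refl aIk
  where
  I≢J : A b j ≢ A b k
  I≢J eq = ℕ.<-irrefl (cong toℕ eq) lt

shared-columns-agree : ∀ {r m n} (A : Matrix r m n) → AvoidsSym F A →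
                       ∀ {j k} → SharedRows A j k → ∀ b → A b j ≡ A b k
shared-columns-agree A avoid {j} {k} shared b with <-cmp (A b j) (A b k)
... | tri< lt _ _ = ⊥-elim (avoid _ _ lt (shared-conflict⇒F-copy A shared b lt))
... | tri≈ _ eq _ = eq
... | tri> _ _ gt = ⊥-elim (avoid _ _ gt (shared-conflict⇒F-copy A (SharedRows-sym A shared) b gt))

witness : ∀ {m} {P : Fin m → Set} → Dec (∃ P) → Fin (suc m)
witness (yes (a , _)) = suc a
witness (no _)        = zero

witness-sound : ∀ {m} {P : Fin m → Set} (d : Dec (∃ P)) {a} → witness d ≡ suc a → P a
witness-sound (yes (a , pa)) refl = pa

witness-complete : ∀ {m} {P : Fin m → Set} (d : Dec (∃ P)) {b} → P b → ∃ λ a → witness d ≡ suc a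
witness-complete (yes (a , _)) _  = a , refl
witness-complete (no ¬p)       pb = ⊥-elim (¬p (_ , pb))

search : ∀ {r m n} (A : Matrix r m n) j w → Dec (∃ λ a → A a j ≡ w)
search A j w = any? (λ a → A a j ≟ w)

occurrence : ∀ {r m n} → Matrix r m n → Fin n → Fin r → Fin (suc m)
occurrence A j w = witness (search A j w)

same-occurrence⇒shared : ∀ {r m n} (A : Matrix r m n) {j k w} →
                         occurrence A j w ≡ occurrence A k w →
                         ∀ b → A b j ≡ w ⊎ A b k ≡ w → ∃ λ a → A a j ≡ w × A a k ≡ w
same-occurrence⇒shared A {j} {k} {w} same b (inj₁ bj)
  with witness-complete (search A j w) bj
... | a , occ = a , witness-sound (search A j w) occ , witness-sound (search A k w) (trans (sym same) occ)
same-occurrence⇒shared A {j} {k} {w} same b (inj₂ bk)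
  with witness-complete (search A k w) bk
... | a , occ = a , witness-sound (search A j w) (trans same occ) , witness-sound (search A k w) occ

otherOccurrences : ∀ {r m n} → Matrix (suc r) (suc m) n → Fin n → Fin r → Fin (suc (suc m))
otherOccurrences A j t = occurrence A j (punchIn (A zero j) t)

profile : ∀ {r m n} → Matrix (suc r) (suc m) n → Fin n → Fin (suc r * suc (suc m) ^ r)
profile A j = combine (A zero j) (funToFin (otherOccurrences A j))

profile-injective : ∀ {r m n} (A : Matrix (suc r) (suc m) n) {j k} → profile A j ≡ profile A k →
                    A zero j ≡ A zero k × (∀ w → A zero j ≢ w → occurrence A j w ≡ occurrence A k w)
profile-injective A {j} {k} eq = same-top , same-occurrence
  where
  same-top : A zero j ≡ A zero k
  same-top = combine-injectiveˡ (A zero j) _ (A zero k) _ eq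

  same-others : ∀ t → otherOccurrences A j t ≡ occurrence A k (punchIn (A zero j) t)
  same-others = funToFin-injective (otherOccurrences A j) (λ t → occurrence A k (punchIn (A zero j) t))
    (trans (combine-injectiveʳ (A zero j) _ (A zero k) _ eq)
           (cong (λ v → funToFin (λ t → occurrence A k (punchIn v t))) (sym same-top)))

  same-occurrence : ∀ w → A zero j ≢ w → occurrence A j w ≡ occurrence A k w
  same-occurrence w top≢w = subst (λ v → occurrence A j v ≡ occurrence A k v)
    (punchIn-punchOut top≢w) (same-others (punchOut top≢w))

-- Columns with equal profiles share rows: the top value in row zero, every
-- other value through its recorded occurrence.
same-profile⇒shared : ∀ {r m n} (A : Matrix (suc r) (suc m) n) {j k} →
                      profile A j ≡ profile A k → SharedRows A j k
same-profile⇒shared A {j} {k} eq w b occurs with profile-injective A eq | A zero j ≟ w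
... | same-top , _ | yes top≡w = zero , top≡w , trans (sym same-top) top≡w
... | _ , same-occurrence | no top≢w = same-occurrence⇒shared A (same-occurrence w top≢w) b occurs

-- Upper bound: a simple Sym(F)-avoiding (r+1)-matrix on m+1 rows has at most
-- (r+1)(m+2)^r columns, as its profile map is injective.
upperBound : ∀ {r m n} (A : Matrix (suc r) (suc m) n) → Simple A → AvoidsSym F A →
             n ≤ suc r * suc (suc m) ^ r
upperBound A simple avoid =
  injective⇒≤ (λ {j} {k} eq → simple j k (shared-columns-agree A avoid (same-profile⇒shared A eq)))

NonzeroOnce : ∀ {r m n} → Matrix (suc r) m n → Set
NonzeroOnce {m = m} {n} A = ∀ (j : Fin n) {a a' : Fin m} t → A a j ≡ suc t → A a' j ≡ suc t → a ≡ a'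

-- Every F(i,j) with i < j repeats the nonzero value j in its second column,
-- so such matrices avoid Sym(F).
nonzeroOnce⇒avoids : ∀ {r m n} (A : Matrix (suc r) m n) → NonzeroOnce A → AvoidsSym F A
nonzeroOnce⇒avoids A once i zero ()
nonzeroOnce⇒avoids A once i (suc t) _ (ρ , γ , ρ-inj , _ , agree)
  with ρ-inj (once (γ (suc zero)) t (agree zero (suc zero)) (agree (suc zero) (suc zero)))
... | ()

-- The block construction on m ≥ s·q rows: row (t,u) is the (t·q+u)-th row;
-- the remaining rows are unlabelled.
module Blocks {s q m : ℕ} (sq≤m : s * q ≤ m) where

  rowAt : Fin s → Fin q → Fin m
  rowAt t u = fromℕ< (ℕ.<-≤-trans (toℕ<n (combine t u)) sq≤m)

  label : Fin m → Maybe (Fin s × Fin q)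
  label a with toℕ a <? s * q
  ... | yes a<sq = just (remQuot q (fromℕ< a<sq))
  ... | no _     = nothing

  label-rowAt : ∀ t u → label (rowAt t u) ≡ just (t , u)
  label-rowAt t u with toℕ (rowAt t u) <? s * q
  ... | yes a<sq = cong just (trans (cong (remQuot {s} q) index) (remQuot-combine t u))
    where
    index : fromℕ< a<sq ≡ combine t u
    index = toℕ-injective (trans (toℕ-fromℕ< a<sq) (toℕ-fromℕ< _))
  ... | no a≮sq = ⊥-elim (a≮sq (subst (_< s * q) (sym (toℕ-fromℕ< _)) (toℕ<n (combine t u))))

  label-just : ∀ a {t u} → label a ≡ just (t , u) → a ≡ rowAt t u
  label-just a eq with toℕ a <? s * q
  label-just a refl | yes a<sq = toℕ-injective (begin
    toℕ a                     ≡⟨ sym (toℕ-fromℕ< a<sq) ⟩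
    toℕ i                     ≡⟨ cong toℕ (sym (combine-remQuot {s} q i)) ⟩
    toℕ (uncurry combine tu)  ≡⟨ sym (toℕ-fromℕ< _) ⟩
    toℕ (uncurry rowAt tu)    ∎)
    where
    open ≡-Reasoning
    i = fromℕ< a<sq
    tu = remQuot {s} q i
  label-just a () | no _

  rowAt-injective : ∀ {t u u'} → rowAt t u ≡ rowAt t u' → u ≡ u'
  rowAt-injective {t} {u} {u'} eq =
    ,-injectiveʳ (just-injective (trans (sym (label-rowAt t u)) (trans (cong label eq) (label-rowAt t u'))))

  entry : Maybe (Fin s × Fin q) → (Fin s → Fin q) → Fin (suc s)
  entry nothing        g = zero
  entry (just (t , u)) g with g t ≟ u
  ... | yes _ = suc t
  ... | no _  = zero

  entry-nonzero : ∀ l g {t} → entry l g ≡ suc t → l ≡ just (t , g t)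
  entry-nonzero (just (t , u)) g eq with g t ≟ u
  entry-nonzero (just (t , u)) g refl | yes gt≡u = cong (λ v → just (t , v)) (sym gt≡u)
  entry-nonzero (just (t , u)) g ()   | no _

  entry-self : ∀ t g → entry (just (t , g t)) g ≡ suc t
  entry-self t g with g t ≟ g t
  ... | yes _   = refl
  ... | no gt≢gt = ⊥-elim (gt≢gt refl)

  blockMatrix : Matrix (suc s) m (q ^ s)
  blockMatrix a j = entry (label a) (finToFun j)

  blockMatrix-at : ∀ j t → blockMatrix (rowAt t (finToFun j t)) j ≡ suc t
  blockMatrix-at j t = trans (cong (λ l → entry l (finToFun j)) (label-rowAt t (finToFun j t)))
                             (entry-self t (finToFun j))

  blockMatrix-only : ∀ j a {t} → blockMatrix a j ≡ suc t → a ≡ rowAt t (finToFun j t)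
  blockMatrix-only j a eq = label-just a (entry-nonzero (label a) (finToFun j) eq)

  blockMatrix-nonzeroOnce : NonzeroOnce blockMatrix
  blockMatrix-nonzeroOnce j {a} {a'} t eq eq' =
    trans (blockMatrix-only j a eq) (sym (blockMatrix-only j a' eq'))

  blockMatrix-simple : Simple blockMatrix
  blockMatrix-simple j k same = finToFun-injective q s j k λ t →
    rowAt-injective (blockMatrix-only k _ (trans (sym (same _)) (blockMatrix-at j t)))

^-distribʳ-* : ∀ a b k → (a * b) ^ k ≡ a ^ k * b ^ k
^-distribʳ-* a b zero    = refl
^-distribʳ-* a b (suc k) = trans (cong (a * b *_) (^-distribʳ-* a b k))
  (solve 4 (λ a b x y → a :* b :* (x :* y) := a :* x :* (b :* y)) refl a b (a ^ k) (b ^ k))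
  where open +-*-Solver

^-bound : ∀ {m c q} k → m ≤ c * q → m ^ k ≤ c ^ k * q ^ k
^-bound {m} {c} {q} k m≤cq = subst (m ^ k ≤_) (^-distribʳ-* c q k) (ℕ.^-monoˡ-≤ k m≤cq)

suc-suc≤double : ∀ m → suc (suc m) ≤ 2 * suc m
suc-suc≤double m = s≤s (ℕ.m<m+n m (s≤s z≤n))

doubling-bound : ∀ c m k → c * suc (suc m) ^ k ≤ c * 2 ^ k * suc m ^ k
doubling-bound c m k = subst (c * suc (suc m) ^ k ≤_) (sym (ℕ.*-assoc c (2 ^ k) (suc m ^ k)))
  (ℕ.*-monoʳ-≤ c (^-bound k (suc-suc≤double m)))

-- For 0 < s ≤ m we have m ≤ 2s·⌊m/s⌋: the remainder is below s ≤ s·⌊m/s⌋.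
≤-double-quotient : ∀ s m .{{_ : NonZero s}} → s ≤ m → m ≤ 2 * s * (m / s)
≤-double-quotient s m s≤m = begin
  m                   ≡⟨ m≡m%n+[m/n]*n m s ⟩
  m % s + q * s       ≤⟨ ℕ.+-monoˡ-≤ (q * s) (ℕ.<⇒≤ (m%n<n m s)) ⟩
  s + q * s           ≤⟨ ℕ.+-monoˡ-≤ (q * s) s≤qs ⟩
  q * s + q * s       ≡⟨ solve 2 (λ s q → q :* s :+ q :* s := con 2 :* s :* q) refl s q ⟩
  2 * s * q           ∎
  where
  open ℕ.≤-Reasoning
  open +-*-Solver
  q = m / s
  s≤qs : s ≤ q * s
  s≤qs = subst (_≤ q * s) (ℕ.*-identityˡ s) (ℕ.*-monoˡ-≤ s (m≥n⇒m/n>0 s≤m))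

lowerBound : ∀ s m .{{_ : NonZero s}} → s ≤ m →
             Σ ℕ λ n → Σ (Matrix (suc s) m n) λ A →
               Simple A × AvoidsSym F A × m ^ s ≤ (2 * s) ^ s * n
lowerBound s m s≤m =
  q ^ s , blockMatrix , blockMatrix-simple , nonzeroOnce⇒avoids blockMatrix blockMatrix-nonzeroOnce ,
  ^-bound s (≤-double-quotient s m s≤m)
  where
  q = m / s
  open Blocks {s} {q} {m} (subst (_≤ m) (ℕ.*-comm q s) (m/n*n≤m m s))

mainTheorem8 : (r : ℕ) → 2 ≤ r →
    Σ ℕ λ a → Σ ℕ λ C → Σ ℕ λ M → (m : ℕ) → M ≤ m →
      ((n : ℕ) (A : Matrix r m n) → Simple A → AvoidsSym F A → n ≤ C * m ^ (r ∸ 1))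
      × (Σ ℕ λ n → Σ (Matrix r m n) λ A → Simple A × AvoidsSym F A × (m ^ (r ∸ 1) ≤ a * n))
mainTheorem8 (suc zero) (s≤s ())
mainTheorem8 (suc (suc s')) _ = (2 * s) ^ s , suc s * 2 ^ s , s , bounds
  where
  s = suc s'
  bounds : (m : ℕ) → s ≤ m →
           ((n : ℕ) (A : Matrix (suc s) m n) → Simple A → AvoidsSym F A → n ≤ suc s * 2 ^ s * m ^ s)
           × (Σ ℕ λ n → Σ (Matrix (suc s) m n) λ A → Simple A × AvoidsSym F A × (m ^ s ≤ (2 * s) ^ s * n))
  bounds (suc m) s≤m =
    (λ n A simple avoid → ℕ.≤-trans (upperBound A simple avoid) (doubling-bound (suc s) m s)) ,
    lowerBound s (suc m) s≤m
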